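{- Let $P_n$ be the path on $n\geq 3$ vertices. Then $\lambda(M(P_n))=6$ if $n\in\{3,4\}$, $\lambda(M(P_n))=7$ if $n=5$, and $\lambda(M(P_n))=n+1$ if $n\geq 6$.
   Context: An $L(2,1)$-labeling of $G$ is a map $f:V\to\{0,1,2,\dots\}$ with $|f(x)-f(y)|\ge 2$ if $d_G(x,y)=1$ and $|f(x)-f(y)|\ge1$ if $d_G(x,y)=2$; $\lambda(G)$ is the minimum over such $f$ of the largest label. For $V=\{v_1,\dots,v_n\}$, the Mycielski graph $M(G)$ has vertex set $V\cup\{v_1',\dots,v_n'\}\cup\{u\}$ and edge set $E\cup\{v_iv_j' : v_iv_j\in E\}\cup\{v_i'u: 1\le i\le n\}$. -}

module Defs where

open import Data.Nat using (ℕ; suc; _≤_; ∣_-_∣)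
open import Data.Fin using (Fin; toℕ)
open import Data.Sum using (_⊎_; inj₁; inj₂)
open import Data.Unit using (⊤; tt)
open import Data.Empty using (⊥)
open import Data.Product using (Σ; ∃; _×_)
open import Relation.Nullary using (¬_)
open import Relation.Binary.PropositionalEquality using (_≡_)

record Graph : Set₁ where
  field
    V   : Set
    Adj : V → V → Set
open Graph public

Path : ℕ → Graph
Path n = record { V = Fin n ; Adj = λ i j → (toℕ j ≡ suc (toℕ i)) ⊎ (toℕ i ≡ suc (toℕ j)) }

-- Mycielski graph M(G): vertices V ⊎ (V' ⊎ {u}), with
--   v_i ~ v_j   iff v_i v_j ∈ E,
--   v_i ~ v_j'  iff v_i v_j ∈ E   (and symmetrically),
--   v_i' ~ u    for all i.
MAdj : (G : Graph) → (V G ⊎ (V G ⊎ ⊤)) → (V G ⊎ (V G ⊎ ⊤)) → Set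
MAdj G (inj₁ x)        (inj₁ y)        = Adj G x y
MAdj G (inj₁ x)        (inj₂ (inj₁ y)) = Adj G x y
MAdj G (inj₁ x)        (inj₂ (inj₂ _)) = ⊥
MAdj G (inj₂ (inj₁ x)) (inj₁ y)        = Adj G x y
MAdj G (inj₂ (inj₁ x)) (inj₂ (inj₁ y)) = ⊥
MAdj G (inj₂ (inj₁ x)) (inj₂ (inj₂ _)) = ⊤
MAdj G (inj₂ (inj₂ _)) (inj₁ y)        = ⊥
MAdj G (inj₂ (inj₂ _)) (inj₂ (inj₁ y)) = ⊤
MAdj G (inj₂ (inj₂ _)) (inj₂ (inj₂ _)) = ⊥

Mycielski : Graph → Graph
Mycielski G = record { V = V G ⊎ (V G ⊎ ⊤) ; Adj = MAdj G }

Dist1 : (G : Graph) → V G → V G → Set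
Dist1 G x y = Adj G x y

Dist2 : (G : Graph) → V G → V G → Set
Dist2 G x y = ¬ (x ≡ y) × ¬ Adj G x y × ∃ λ z → Adj G x z × Adj G z y

IsL21 : (G : Graph) → (V G → ℕ) → Set
IsL21 G f =
  (∀ x y → Dist1 G x y → 2 ≤ ∣ f x - f y ∣) ×
  (∀ x y → Dist2 G x y → 1 ≤ ∣ f x - f y ∣)

HasL21Within : Graph → ℕ → Set
HasL21Within G k = Σ (V G → ℕ) λ f → IsL21 G f × (∀ v → f v ≤ k)

LambdaIs : Graph → ℕ → Set
LambdaIs G k = HasL21Within G k × (∀ m → HasL21Within G m → k ≤ m)

module Submission where

-- Every shadow v_i′ is adjacent to the apex u, and any two shadows are at distance two through u,
-- so the shadows carry n distinct labels avoiding the three values around the label of u; this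
-- forces λ ≥ n + 1.  For n = 3, 4, 5 the larger values 6, 6, 7 are certified by a verified
-- backtracking search which finds no labelling of smaller span.  Conversely, for n ≥ 10 take the
-- odd N ∈ {n, n + 1}, label u by n + 1 and v_i′, v_i by the residues of 2i + 1 and 2i + 6 modulo N:
-- every constraint then compares two residues differing by a fixed offset d ≤ 9, which stays away
-- from 0 modulo N ≥ 11, and the shadow labels are distinct because 2 is invertible modulo N.
-- For 3 ≤ n ≤ 9 explicit labellings are checked by computation.

open import Defs
open import Data.Bool using (Bool; true; false; T; _∧_; if_then_else_)
open import Data.Bool.ListAction using (any; all)
open import Data.Bool.Properties using (T-∧)
open import Data.Empty using (⊥-elim)
open import Data.Fin as Fin using (Fin; toℕ; fromℕ<)
open import Data.Fin.Properties using (toℕ-injective; toℕ<n; toℕ-fromℕ<; pigeonhole)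
import Data.Fin.Properties as Finₚ
open import Data.List using (List; []; _∷_; upTo; allFin; concatMap)
open import Data.List.Membership.Propositional using (_∈_)
open import Data.List.Membership.Propositional.Properties
  using (∈-upTo⁺; ∈-allFin; ∈-concatMap⁺)
open import Data.List.Relation.Unary.All as All using (All; []; _∷_)
open import Data.List.Relation.Unary.All.Properties using (all⁺; all⁻)
open import Data.List.Relation.Unary.Any as Any using (here; there; satisfied)
open import Data.List.Relation.Unary.Any.Properties using (any⁺; any⁻)
open import Data.Nat as ℕ
  using ( ℕ; zero; suc; _+_; _*_; _∸_; _%_; _/_; _≤_; _<_; _≤?_; _<?_; _≤ᵇ_; ∣_-_∣
        ; z≤n; s≤s; s≤s⁻¹; NonZero; >-nonZero )
open import Data.Nat.Coprimality using (Coprime; coprime-divisor)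
open import Data.Nat.DivMod
open import Data.Nat.Divisibility
  using (_∣_; _∣?_; divides; n∣m*n; ∣m+n∣m⇒∣n; ∣⇒≤; ∣1⇒≡1; 0∣⇒≡0)
open import Data.Nat.Properties
open import Data.Product using (_×_; _,_; proj₁; proj₂)
open import Data.Sum using (_⊎_; inj₁; inj₂)
open import Data.Sum.Properties using (≡-dec)
open import Data.Unit as Unit using (tt)
open import Data.Vec using (Vec; lookup; _∷_; [])
open import Function using (id; _∘_)
open import Function.Bundles using (Equivalence)
open import Function.Definitions using (Injective)
open import Relation.Binary.Definitions using (DecidableEquality; tri<; tri≈; tri>)
open import Relation.Binary.PropositionalEquality
  using (_≡_; _≢_; refl; sym; trans; cong; subst; module ≡-Reasoning)
open import Relation.Nullary using (¬_; Dec; yes; no; contradiction)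
open import Relation.Nullary.Decidable
  using (_⊎-dec_; isYes; isNo; toWitness; toWitnessFalse; fromWitness; fromWitnessFalse)

∣-∣-swap : ∀ {g} m n → g ≤ ∣ m - n ∣ → g ≤ ∣ n - m ∣
∣-∣-swap {g} m n = subst (g ≤_) (∣-∣-comm m n)

≢⇒1≤∣m-n∣ : ∀ {m n} → m ≢ n → 1 ≤ ∣ m - n ∣
≢⇒1≤∣m-n∣ m≢n = n≢0⇒n>0 (m≢n ∘ ∣m-n∣≡0⇒m≡n)

+≤⇒≤∣m-n∣ : ∀ {g} m n → g + m ≤ n → g ≤ ∣ m - n ∣
+≤⇒≤∣m-n∣ {g} m n g+m≤n =
  subst (g ≤_) (sym (m≤n⇒∣m-n∣≡n∸m (m+n≤o⇒n≤o g g+m≤n))) (m+n≤o⇒m≤o∸n g g+m≤n)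

2≤∣m-n∣⇒2+m≤n⊎2+n≤m : ∀ m n → 2 ≤ ∣ m - n ∣ → 2 + m ≤ n ⊎ 2 + n ≤ m
2≤∣m-n∣⇒2+m≤n⊎2+n≤m zero    n       2≤n   = inj₁ 2≤n
2≤∣m-n∣⇒2+m≤n⊎2+n≤m (suc m) zero    2≤1+m = inj₂ 2≤1+m
2≤∣m-n∣⇒2+m≤n⊎2+n≤m (suc m) (suc n) 2≤∣m-n∣ with 2≤∣m-n∣⇒2+m≤n⊎2+n≤m m n 2≤∣m-n∣
... | inj₁ 2+m≤n = inj₁ (s≤s 2+m≤n)
... | inj₂ 2+n≤m = inj₂ (s≤s 2+n≤m)

-- Removes the two values nearest to c, which no x far from c can take.
squeeze : ∀ {c x} → 2 + x ≤ c ⊎ 2 + c ≤ x → ℕ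
squeeze {x = x} (inj₁ _) = x
squeeze {x = x} (inj₂ _) = x ∸ 2

squeeze-bound : ∀ {c x m} (far : 2 + x ≤ c ⊎ 2 + c ≤ x) → x ≤ m → c ≤ m → 2 + squeeze far ≤ m
squeeze-bound (inj₁ 2+x≤c) x≤m c≤m = ≤-trans 2+x≤c c≤m
squeeze-bound (inj₂ 2+c≤x) x≤m c≤m =
  subst (_≤ _) (sym (m+[n∸m]≡n (≤-trans (m≤m+n 2 _) 2+c≤x))) x≤m

squeeze-separates : ∀ {c x y} → 2 + x ≤ c → 2 + c ≤ y → x ≢ y ∸ 2
squeeze-separates 2+x≤c 2+c≤y x≡y∸2 = <⇒≱ (≤-trans (n≤1+n _) 2+c≤y)
  (subst (_≤ _) (trans (cong (2 +_) x≡y∸2) (m+[n∸m]≡n (≤-trans (m≤m+n 2 _) 2+c≤y))) 2+x≤c)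

squeeze-injective : ∀ {c x y} (far-x : 2 + x ≤ c ⊎ 2 + c ≤ x) (far-y : 2 + y ≤ c ⊎ 2 + c ≤ y) →
                    squeeze far-x ≡ squeeze far-y → x ≡ y
squeeze-injective (inj₁ _) (inj₁ _) x≡y = x≡y
squeeze-injective {x = x} {y} (inj₂ 2+c≤x) (inj₂ 2+c≤y) x∸2≡y∸2 = begin
  x           ≡⟨ m+[n∸m]≡n (≤-trans (m≤m+n 2 _) 2+c≤x) ⟨
  2 + (x ∸ 2) ≡⟨ cong (2 +_) x∸2≡y∸2 ⟩
  2 + (y ∸ 2) ≡⟨ m+[n∸m]≡n (≤-trans (m≤m+n 2 _) 2+c≤y) ⟩
  y           ∎
  where open ≡-Reasoning
squeeze-injective (inj₁ 2+x≤c) (inj₂ 2+c≤y) x≡y∸2 =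
  contradiction x≡y∸2 (squeeze-separates 2+x≤c 2+c≤y)
squeeze-injective (inj₂ 2+c≤x) (inj₁ 2+y≤c) x∸2≡y =
  contradiction (sym x∸2≡y) (squeeze-separates 2+y≤c 2+c≤x)

¬2∣⇒coprime-2 : ∀ {m} → ¬ 2 ∣ m → Coprime m 2
¬2∣⇒coprime-2 ¬2∣m {zero}              (_   , 0∣2) = contradiction (0∣⇒≡0 0∣2) λ ()
¬2∣⇒coprime-2 ¬2∣m {1}                 _           = refl
¬2∣⇒coprime-2 ¬2∣m {2}                 (2∣m , _)   = contradiction 2∣m ¬2∣m
¬2∣⇒coprime-2 ¬2∣m {suc (suc (suc _))} (_   , d∣2) = contradiction (∣⇒≤ d∣2) λ { (s≤s (s≤s ())) }

module _ {N : ℕ} .{{_ : NonZero N}} where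
  open ≡-Reasoning

  [m+n]%N≡[m+n%N]%N : ∀ m n → (m + n) % N ≡ (m + n % N) % N
  [m+n]%N≡[m+n%N]%N m n = begin
    (m + n) % N                    ≡⟨ cong (λ t → (m + t) % N) (m≡m%n+[m/n]*n n N) ⟩
    (m + (n % N + n / N * N)) % N  ≡⟨ cong (_% N) (+-assoc m (n % N) _) ⟨
    (m + n % N + n / N * N) % N    ≡⟨ [m+kn]%n≡m%n (m + n % N) (n / N) N ⟩
    (m + n % N) % N                ∎

  %-wrap : ∀ {m} → N ≤ m → m < N + N → m % N + N ≡ m
  %-wrap {m} N≤m m<2N = begin
    m % N + N       ≡⟨ cong (_+ N) (m≤n⇒[n∸m]%m≡n%m N≤m) ⟨
    (m ∸ N) % N + N ≡⟨ cong (_+ N) (m<n⇒m%n≡m (m<n+o⇒m∸n<o m N m<2N)) ⟩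
    m ∸ N + N       ≡⟨ m∸n+n≡m N≤m ⟩
    m               ∎

  -- Shifting by d moves a residue by d or by N ∸ d around the cycle ℤ/N.
  %-gap : ∀ {g} d x → g ≤ d → g + d ≤ N → g ≤ ∣ (d + x) % N - x % N ∣
  %-gap {g} d x g≤d g+d≤N with d + x % N <? N
  ... | yes unwrapped = subst (g ≤_) (sym distance) g≤d
    where
    r : ℕ
    r = x % N
    distance : ∣ (d + x) % N - r ∣ ≡ d
    distance = begin
      ∣ (d + x) % N - r ∣ ≡⟨ cong ∣_- r ∣ ([m+n]%N≡[m+n%N]%N d x) ⟩
      ∣ (d + r) % N - r ∣ ≡⟨ cong ∣_- r ∣ (m<n⇒m%n≡m unwrapped) ⟩
      ∣ d + r - r ∣       ≡⟨ ∣-∣-comm (d + r) r ⟩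
      ∣ r - d + r ∣       ≡⟨ cong ∣ r -_∣ (+-comm d r) ⟩
      ∣ r - r + d ∣       ≡⟨ ∣m-m+n∣≡n r d ⟩
      d                   ∎
  ... | no wrapped = subst (g ≤_) (sym distance) (m+n≤o⇒m≤o∸n g g+d≤N)
    where
    r y : ℕ
    r = x % N
    y = (d + r) % N
    d≤N : d ≤ N
    d≤N = m+n≤o⇒n≤o g g+d≤N
    y+N≡d+r : y + N ≡ d + r
    y+N≡d+r = %-wrap (≮⇒≥ wrapped) (+-mono-≤-< d≤N (m%n<n x N))
    r≡y+[N∸d] : r ≡ y + (N ∸ d)
    r≡y+[N∸d] = +-cancelʳ-≡ d r (y + (N ∸ d)) (begin
      r + d           ≡⟨ +-comm r d ⟩
      d + r           ≡⟨ y+N≡d+r ⟨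
      y + N           ≡⟨ cong (y +_) (m∸n+n≡m d≤N) ⟨
      y + (N ∸ d + d) ≡⟨ +-assoc y (N ∸ d) d ⟨
      y + (N ∸ d) + d ∎)
    distance : ∣ (d + x) % N - r ∣ ≡ N ∸ d
    distance = begin
      ∣ (d + x) % N - r ∣ ≡⟨ cong ∣_- r ∣ ([m+n]%N≡[m+n%N]%N d x) ⟩
      ∣ y - r ∣           ≡⟨ cong ∣ y -_∣ r≡y+[N∸d] ⟩
      ∣ y - y + (N ∸ d) ∣ ≡⟨ ∣m-m+n∣≡n y (N ∸ d) ⟩
      N ∸ d               ∎

  %-shift⇒∣ : ∀ d x → (d + x) % N ≡ x % N → N ∣ d
  %-shift⇒∣ d x same = ∣m+n∣m⇒∣n (divides ((d + x) / N) multiple) (n∣m*n (x / N))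
    where
    multiple : x / N * N + d ≡ (d + x) / N * N
    multiple = +-cancelˡ-≡ (x % N) _ _ (begin
      x % N + (x / N * N + d)        ≡⟨ +-assoc (x % N) _ d ⟨
      x % N + x / N * N + d          ≡⟨ cong (_+ d) (m≡m%n+[m/n]*n x N) ⟨
      x + d                          ≡⟨ +-comm x d ⟩
      d + x                          ≡⟨ m≡m%n+[m/n]*n (d + x) N ⟩
      (d + x) % N + (d + x) / N * N  ≡⟨ cong (_+ (d + x) / N * N) same ⟩
      x % N + (d + x) / N * N        ∎)

-- Deciding L(2,1)-labellings of finite graphs

hasL21Within-mono : ∀ {G k l} → k ≤ l → HasL21Within G k → HasL21Within G l
hasL21Within-mono k≤l (f , isL21 , f≤k) = f , isL21 , λ v → ≤-trans (f≤k v) k≤l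

¬hasL21Within⇒< : ∀ {G k} → ¬ HasL21Within G k → ∀ m → HasL21Within G m → k < m
¬hasL21Within⇒< {k = k} none m has with m ≤? k
... | yes m≤k = contradiction (hasL21Within-mono m≤k has) none
... | no  m≰k = ≰⇒> m≰k

module FiniteL21 (G : Graph) (_≟_ : DecidableEquality (V G))
                 (adj? : ∀ x y → Dec (Adj G x y)) (vertices : List (V G)) where

  adjacent : V G → V G → Bool
  adjacent x y = isYes (adj? x y)

  commonNeighbour : V G → V G → V G → Bool
  commonNeighbour x y z = adjacent x z ∧ adjacent z y

  atDistanceTwo : V G → V G → Bool
  atDistanceTwo x y = isNo (x ≟ y) ∧ (isNo (adj? x y) ∧ any (commonNeighbour x y) vertices)

  atDistanceTwo-sound : ∀ x y → T (atDistanceTwo x y) → Dist2 G x y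
  atDistanceTwo-sound x y t =
    let x≢y , rest   = Equivalence.to (T-∧ {isNo (x ≟ y)}) t
        x≁y , common = Equivalence.to (T-∧ {isNo (adj? x y)}) rest
        z , x∼z∧z∼y  = satisfied (any⁻ (commonNeighbour x y) vertices common)
        x∼z , z∼y    = Equivalence.to (T-∧ {adjacent x z}) x∼z∧z∼y
    in  toWitnessFalse {a? = x ≟ y} x≢y , toWitnessFalse {a? = adj? x y} x≁y ,
        z , toWitness {a? = adj? x z} x∼z , toWitness {a? = adj? z y} z∼y

  requiredGap : V G → V G → ℕ
  requiredGap x y = if adjacent x y then 2 else if atDistanceTwo x y then 1 else 0

  requiredGap-respected : ∀ {f} → IsL21 G f → ∀ x y → requiredGap x y ≤ ∣ f x - f y ∣
  requiredGap-respected (dist1 , dist2) x y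
    with adj? x y | atDistanceTwo x y | atDistanceTwo-sound x y
  ... | yes x∼y | _     | _     = dist1 x y x∼y
  ... | no  _   | true  | sound = dist2 x y (sound tt)
  ... | no  _   | false | _     = z≤n

  Assignment : Set
  Assignment = List (V G × ℕ)

  fits : V G → ℕ → Assignment → Bool
  fits v l = all (λ (w , l′) → requiredGap v w ≤ᵇ ∣ l - l′ ∣)

  extendable : ℕ → List (V G) → Assignment → Bool
  extendable k []       σ = true
  extendable k (v ∷ vs) σ =
    any (λ l → fits v l σ ∧ extendable k vs ((v , l) ∷ σ)) (upTo (suc k))

  extendable-complete : ∀ {f k} → IsL21 G f → (∀ v → f v ≤ k) →
                        ∀ vs σ → All (λ (w , l) → f w ≡ l) σ → T (extendable k vs σ)
  extendable-complete         isL21 f≤k []       σ _     = tt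
  extendable-complete {f} {k} isL21 f≤k (v ∷ vs) σ agree =
    any⁺ _ (Any.map (λ { refl → Equivalence.from T-∧ (fv-fits , rest) }) (∈-upTo⁺ (s≤s (f≤k v))))
    where
    fv-fits : T (fits v (f v) σ)
    fv-fits = all⁻ _ (All.map (λ { {w , _} refl → ≤⇒≤ᵇ (requiredGap-respected {f} isL21 v w) }) agree)
    rest : T (extendable k vs ((v , f v) ∷ σ))
    rest = extendable-complete isL21 f≤k vs ((v , f v) ∷ σ) (refl ∷ agree)

  ¬hasL21Within-bySearch : ∀ k vs → extendable k vs [] ≡ false → ¬ HasL21Within G k
  ¬hasL21Within-bySearch k vs exhausted (f , isL21 , f≤k) =
    subst T exhausted (extendable-complete isL21 f≤k vs [] [])

  gapsRespected : (V G → ℕ) → Bool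
  gapsRespected f = all (λ x → all (λ y → requiredGap x y ≤ᵇ ∣ f x - f y ∣) vertices) vertices

  boundedBy : ℕ → (V G → ℕ) → Bool
  boundedBy k f = all (λ v → f v ≤ᵇ k) vertices

  module _ (every : ∀ v → v ∈ vertices) where

    atDistanceTwo-complete : ∀ x y → Dist2 G x y → T (atDistanceTwo x y)
    atDistanceTwo-complete x y (x≢y , x≁y , z , x∼z , z∼y) =
      Equivalence.from (T-∧ {isNo (x ≟ y)}) (fromWitnessFalse x≢y ,
        Equivalence.from (T-∧ {isNo (adj? x y)}) (fromWitnessFalse x≁y ,
          any⁺ (commonNeighbour x y) (Any.map common (every z))))
      where
      common : ∀ {w} → z ≡ w → T (commonNeighbour x y w)
      common refl = Equivalence.from (T-∧ {adjacent x z}) (fromWitness x∼z , fromWitness z∼y)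

    requiredGap-dist1 : ∀ x y → Dist1 G x y → requiredGap x y ≡ 2
    requiredGap-dist1 x y x∼y with adj? x y
    ... | yes _   = refl
    ... | no  x≁y = contradiction x∼y x≁y

    requiredGap-dist2 : ∀ x y → Dist2 G x y → requiredGap x y ≡ 1
    requiredGap-dist2 x y d@(_ , x≁y , _)
      with adj? x y | atDistanceTwo x y | atDistanceTwo-complete x y d
    ... | yes x∼y | _    | _ = contradiction x∼y x≁y
    ... | no  _   | true | _ = refl

    hasL21Within-byCheck : ∀ k f → T (gapsRespected f ∧ boundedBy k f) → HasL21Within G k
    hasL21Within-byCheck k f checked =
      f , (apart requiredGap-dist1 , apart requiredGap-dist2) , bounded
      where
      gaps-ok : All (λ x → T (all (λ y → requiredGap x y ≤ᵇ ∣ f x - f y ∣) vertices)) vertices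
      gaps-ok = all⁺ _ _ (proj₁ (Equivalence.to T-∧ checked))
      apart : ∀ {R : V G → V G → Set} {g} → (∀ x y → R x y → requiredGap x y ≡ g) →
              ∀ x y → R x y → g ≤ ∣ f x - f y ∣
      apart gap≡ x y r = subst (_≤ ∣ f x - f y ∣) (gap≡ x y r)
        (≤ᵇ⇒≤ _ _ (All.lookup (all⁺ _ _ (All.lookup gaps-ok (every x))) (every y)))
      bounded : ∀ v → f v ≤ k
      bounded v = ≤ᵇ⇒≤ _ _ (All.lookup (all⁺ _ _ (proj₂ (Equivalence.to T-∧ checked))) (every v))

pattern original x = inj₁ x
pattern shadow x   = inj₂ (inj₁ x)
pattern apex       = inj₂ (inj₂ tt)

mycielski-≟ : {G : Graph} → DecidableEquality (V G) → DecidableEquality (V (Mycielski G))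
mycielski-≟ _≟_ = ≡-dec _≟_ (≡-dec _≟_ Unit._≟_)

mycielskiAdj? : {G : Graph} → (∀ x y → Dec (Adj G x y)) → ∀ x y → Dec (Adj (Mycielski G) x y)
mycielskiAdj? adj? (original x) (original y) = adj? x y
mycielskiAdj? adj? (original x) (shadow y)   = adj? x y
mycielskiAdj? adj? (original x) apex         = no λ ()
mycielskiAdj? adj? (shadow x)   (original y) = adj? x y
mycielskiAdj? adj? (shadow x)   (shadow y)   = no λ ()
mycielskiAdj? adj? (shadow x)   apex         = yes tt
mycielskiAdj? adj? apex         (original y) = no λ ()
mycielskiAdj? adj? apex         (shadow y)   = yes tt
mycielskiAdj? adj? apex         apex         = no λ ()

-- Listing the apex first and each shadow next to its original keeps the search prunable.
mycielskiVertices : {G : Graph} → List (V G) → List (V (Mycielski G))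
mycielskiVertices vs = apex ∷ concatMap (λ x → shadow x ∷ original x ∷ []) vs

∈-mycielskiVertices : {G : Graph} {vs : List (V G)} →
                      (∀ x → x ∈ vs) → ∀ v → v ∈ mycielskiVertices {G} vs
∈-mycielskiVertices every (original x) =
  there (∈-concatMap⁺ _ (Any.map (λ { refl → there (here refl) }) (every x)))
∈-mycielskiVertices every (shadow x)   =
  there (∈-concatMap⁺ _ (Any.map (λ { refl → here refl }) (every x)))
∈-mycielskiVertices every apex         = here refl

mycielskiLabelling : {G : Graph} → (V G → ℕ) → (V G → ℕ) → ℕ → V (Mycielski G) → ℕ
mycielskiLabelling a a′ c (original x) = a x
mycielskiLabelling a a′ c (shadow x)   = a′ x
mycielskiLabelling a a′ c apex         = c

module _ {G : Graph} {f : V (Mycielski G) → ℕ} (isL21 : IsL21 (Mycielski G) f) where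

  shadow-far-from-apex : ∀ x → 2 ≤ ∣ f (shadow x) - f apex ∣
  shadow-far-from-apex x = proj₁ isL21 (shadow x) apex tt

  shadows-distinct : ∀ {x y} → x ≢ y → f (shadow x) ≢ f (shadow y)
  shadows-distinct {x} {y} x≢y fx≡fy = <⇒≱ apart (≤-reflexive (m≡n⇒∣m-n∣≡0 fx≡fy))
    where
    apart : 1 ≤ ∣ f (shadow x) - f (shadow y) ∣
    apart = proj₂ isL21 _ _ ((λ { refl → x≢y refl }) , (λ ()) , apex , tt , tt)

mycielski-λ≥1+ : ∀ {G n m} (e : Fin n → V G) → Injective _≡_ _≡_ e → 1 ≤ n →
                 HasL21Within (Mycielski G) m → n + 1 ≤ m
mycielski-λ≥1+ {G} {n} {m} e e-injective 1≤n (f , isL21 , f≤m) = m≤o∸n⇒m+n≤o n 1≤m n≤m∸1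
  where
  label : Fin n → ℕ
  label i = f (shadow (e i))
  far : ∀ i → 2 + label i ≤ f apex ⊎ 2 + f apex ≤ label i
  far i = 2≤∣m-n∣⇒2+m≤n⊎2+n≤m _ _ (shadow-far-from-apex {G} {f} isL21 (e i))
  code : Fin n → Fin (m ∸ 1)
  code i = fromℕ< (m+n≤o⇒m≤o∸n (suc (squeeze (far i)))
    (subst (_≤ m) (cong suc (+-comm 1 _)) (squeeze-bound (far i) (f≤m _) (f≤m _))))
  collision : ∀ {i j} → i Fin.< j → code i ≢ code j
  collision {i} {j} i<j code-i≡code-j =
    shadows-distinct {G} {f} isL21 (Finₚ.<⇒≢ i<j ∘ e-injective) (squeeze-injective (far i) (far j)
      (trans (sym (toℕ-fromℕ< _)) (trans (cong toℕ code-i≡code-j) (toℕ-fromℕ< _))))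
  n≤m∸1 : n ≤ m ∸ 1
  n≤m∸1 with m ∸ 1 <? n
  ... | no  m∸1≮n = ≮⇒≥ m∸1≮n
  ... | yes m∸1<n with pigeonhole m∸1<n code
  ...   | i , j , i<j , code-i≡code-j = contradiction code-i≡code-j (collision i<j)
  1≤m : 1 ≤ m
  1≤m = ≤-trans (≤-trans 1≤n n≤m∸1) (m∸n≤m m 1)

-- Mycielski graphs of paths

pathAdj? : ∀ {n} (i j : Fin n) → Dec (Adj (Path n) i j)
pathAdj? i j = (toℕ j ℕ.≟ suc (toℕ i)) ⊎-dec (toℕ i ℕ.≟ suc (toℕ j))

module MycielskiPath (n : ℕ) where
  open FiniteL21 (Mycielski (Path n)) (mycielski-≟ {Path n} Fin._≟_)
                 (mycielskiAdj? {Path n} pathAdj?) (mycielskiVertices {Path n} (allFin n)) public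

  ¬hasL21Within : ∀ k → extendable k (mycielskiVertices {Path n} (allFin n)) [] ≡ false →
                  ¬ HasL21Within (Mycielski (Path n)) k
  ¬hasL21Within k = ¬hasL21Within-bySearch k (mycielskiVertices {Path n} (allFin n))

  vecLabelling : Vec ℕ n → Vec ℕ n → ℕ → V (Mycielski (Path n)) → ℕ
  vecLabelling a a′ = mycielskiLabelling {Path n} (lookup a) (lookup a′)

  hasL21Within : ∀ k (a a′ : Vec ℕ n) c →
                 T (gapsRespected (vecLabelling a a′ c) ∧ boundedBy k (vecLabelling a a′ c)) →
                 HasL21Within (Mycielski (Path n)) k
  hasL21Within k a a′ c =
    hasL21Within-byCheck (∈-mycielskiVertices {Path n} ∈-allFin) k (vecLabelling a a′ c)

path-two-steps : ∀ {n} {x z y : Fin n} → Adj (Path n) x z → Adj (Path n) z y →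
                 (toℕ y ≡ 2 + toℕ x ⊎ toℕ x ≡ 2 + toℕ y) ⊎ toℕ x ≡ toℕ y
path-two-steps (inj₁ z≡1+x) (inj₁ y≡1+z) = inj₁ (inj₁ (trans y≡1+z (cong suc z≡1+x)))
path-two-steps (inj₂ x≡1+z) (inj₂ z≡1+y) = inj₁ (inj₂ (trans x≡1+z (cong suc z≡1+y)))
path-two-steps (inj₁ z≡1+x) (inj₂ z≡1+y) = inj₂ (suc-injective (trans (sym z≡1+x) z≡1+y))
path-two-steps (inj₂ x≡1+z) (inj₁ y≡1+z) = inj₂ (trans x≡1+z (sym y≡1+z))

-- a i, a′ i and c are the labels of v_i, v_i′ and u.
record PathConstraints (n : ℕ) (a a′ : ℕ → ℕ) (c : ℕ) : Set where
  field
    originals-adjacent        : ∀ i → 1 + i < n → 2 ≤ ∣ a i - a (1 + i) ∣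
    original-next-shadow      : ∀ i → 1 + i < n → 2 ≤ ∣ a i - a′ (1 + i) ∣
    shadow-next-original      : ∀ i → 1 + i < n → 2 ≤ ∣ a′ i - a (1 + i) ∣
    shadow-apex               : ∀ i → i < n → 2 ≤ ∣ a′ i - c ∣
    originals-two-apart       : ∀ i → 2 + i < n → 1 ≤ ∣ a i - a (2 + i) ∣
    original-shadow-two-apart : ∀ i → 2 + i < n → 1 ≤ ∣ a i - a′ (2 + i) ∣
    shadow-original-two-apart : ∀ i → 2 + i < n → 1 ≤ ∣ a′ i - a (2 + i) ∣
    original-own-shadow       : ∀ i → i < n → 1 ≤ ∣ a i - a′ i ∣
    original-apex             : ∀ i → i < n → 1 ≤ ∣ a i - c ∣
    shadows-injective         : ∀ i j → i < n → j < n → i ≢ j → a′ i ≢ a′ j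

pathMycielskiLabelling : ∀ {n} → (ℕ → ℕ) → (ℕ → ℕ) → ℕ → V (Mycielski (Path n)) → ℕ
pathMycielskiLabelling {n} a a′ = mycielskiLabelling {Path n} (a ∘ toℕ) (a′ ∘ toℕ)

module _ {n a a′ c} (constraints : PathConstraints n a a′ c) where
  open PathConstraints constraints

  private
    f : V (Mycielski (Path n)) → ℕ
    f = pathMycielskiLabelling {n} a a′ c

    at-offset : ∀ {g} d (p q : ℕ → ℕ) →
                (∀ i → d + i < n → g ≤ ∣ p i - q (d + i) ∣) →
                (∀ i → d + i < n → g ≤ ∣ q i - p (d + i) ∣) →
                ∀ (x y : Fin n) → toℕ y ≡ d + toℕ x ⊎ toℕ x ≡ d + toℕ y →
                g ≤ ∣ p (toℕ x) - q (toℕ y) ∣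
    at-offset {g} d p q forward backward x y (inj₁ y≡d+x) =
      subst (λ t → g ≤ ∣ p (toℕ x) - q t ∣) (sym y≡d+x)
        (forward (toℕ x) (subst (_< n) y≡d+x (toℕ<n y)))
    at-offset {g} d p q forward backward x y (inj₂ x≡d+y) =
      subst (λ t → g ≤ ∣ p t - q (toℕ y) ∣) (sym x≡d+y)
        (∣-∣-swap (q (toℕ y)) (p (d + toℕ y)) (backward (toℕ y) (subst (_< n) x≡d+y (toℕ<n x))))

    two-steps : ∀ (p q : ℕ → ℕ) →
                (∀ i → 2 + i < n → 1 ≤ ∣ p i - q (2 + i) ∣) →
                (∀ i → 2 + i < n → 1 ≤ ∣ q i - p (2 + i) ∣) →
                ∀ x {z} y → (toℕ x ≡ toℕ y → 1 ≤ ∣ p (toℕ x) - q (toℕ y) ∣) →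
                Adj (Path n) x z → Adj (Path n) z y → 1 ≤ ∣ p (toℕ x) - q (toℕ y) ∣
    two-steps p q forward backward x y same x∼z z∼y with path-two-steps x∼z z∼y
    ... | inj₁ offset = at-offset 2 p q forward backward x y offset
    ... | inj₂ x≡y    = same x≡y

    originals-two-steps : ∀ (x : Fin n) {z} y → x ≢ y →
                          Adj (Path n) x z → Adj (Path n) z y → 1 ≤ ∣ a (toℕ x) - a (toℕ y) ∣
    originals-two-steps x y x≢y =
      two-steps a a originals-two-apart originals-two-apart x y (⊥-elim ∘ x≢y ∘ toℕ-injective)

    own-shadow : ∀ (x y : Fin n) → toℕ x ≡ toℕ y → 1 ≤ ∣ a (toℕ x) - a′ (toℕ y) ∣
    own-shadow x y x≡y =
      subst (λ t → 1 ≤ ∣ a (toℕ x) - a′ t ∣) x≡y (original-own-shadow (toℕ x) (toℕ<n x))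

    dist1 : ∀ x y → Dist1 (Mycielski (Path n)) x y → 2 ≤ ∣ f x - f y ∣
    dist1 (original x) (original y) x∼y =
      at-offset 1 a a originals-adjacent originals-adjacent x y x∼y
    dist1 (original x) (shadow y)   x∼y =
      at-offset 1 a a′ original-next-shadow shadow-next-original x y x∼y
    dist1 (shadow x)   (original y) x∼y =
      at-offset 1 a′ a shadow-next-original original-next-shadow x y x∼y
    dist1 (shadow x)   apex         _   = shadow-apex (toℕ x) (toℕ<n x)
    dist1 apex         (shadow y)   _   = ∣-∣-swap (a′ (toℕ y)) c (shadow-apex (toℕ y) (toℕ<n y))

    dist2 : ∀ x y → Dist2 (Mycielski (Path n)) x y → 1 ≤ ∣ f x - f y ∣
    dist2 (original x) (original y) (x≢y , _ , original z , x∼z , z∼y) =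
      originals-two-steps x y (x≢y ∘ cong original) x∼z z∼y
    dist2 (original x) (original y) (x≢y , _ , shadow z , x∼z , z∼y)   =
      originals-two-steps x y (x≢y ∘ cong original) x∼z z∼y
    dist2 (original x) (shadow y)   (_ , _ , original z , x∼z , z∼y)   =
      two-steps a a′ original-shadow-two-apart shadow-original-two-apart x y (own-shadow x y) x∼z z∼y
    dist2 (original x) apex         _                                   =
      original-apex (toℕ x) (toℕ<n x)
    dist2 (shadow x)   (original y) (_ , _ , original z , x∼z , z∼y)   =
      two-steps a′ a shadow-original-two-apart original-shadow-two-apart x y
        (∣-∣-swap (a (toℕ y)) (a′ (toℕ x)) ∘ own-shadow y x ∘ sym) x∼z z∼y
    dist2 (shadow x)   (shadow y)   (x′≢y′ , _)                         =
      ≢⇒1≤∣m-n∣ (shadows-injective (toℕ x) (toℕ y) (toℕ<n x) (toℕ<n y)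
        (x′≢y′ ∘ cong shadow ∘ toℕ-injective))
    dist2 (shadow x)   apex         (_ , x′≁u , _)                      = contradiction tt x′≁u
    dist2 apex         (original y) _                                   =
      ∣-∣-swap (a (toℕ y)) c (original-apex (toℕ y) (toℕ<n y))
    dist2 apex         (shadow y)   (_ , u≁y′ , _)                      = contradiction tt u≁y′
    dist2 apex         apex         (u≢u , _)                           = contradiction refl u≢u
    dist2 (original _) (original _) (_ , _ , apex , () , _)
    dist2 (original _) (shadow _)   (_ , _ , shadow _ , _ , ())
    dist2 (original _) (shadow _)   (_ , _ , apex , () , _)
    dist2 (shadow _)   (original _) (_ , _ , shadow _ , () , _)
    dist2 (shadow _)   (original _) (_ , _ , apex , _ , ())

  pathConstraints⇒isL21 : IsL21 (Mycielski (Path n)) f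
  pathConstraints⇒isL21 = dist1 , dist2

-- position i = 2i + 1 is defined by recursion so that the labels at i + 1 and i + 2 are
-- definitionally offsets of the labels at i.
module CyclicLabelling (N : ℕ) .{{_ : NonZero N}} (N-odd : ¬ 2 ∣ N) (10≤N : 10 ≤ N) where

  position : ℕ → ℕ
  position zero    = 1
  position (suc i) = 2 + position i

  originalLabel shadowLabel : ℕ → ℕ
  originalLabel i = (5 + position i) % N
  shadowLabel   i = position i % N

  position-+ : ∀ k i → position (k + i) ≡ 2 * k + position i
  position-+ zero    i = refl
  position-+ (suc k) i =
    trans (cong (2 +_) (position-+ k i)) (cong (_+ position i) (sym (*-suc 2 k)))

  position≡ : ∀ i → position i ≡ i + suc i
  position≡ zero    = refl
  position≡ (suc i) = cong suc (trans (cong suc (position≡ i)) (sym (+-suc i (suc i))))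

  shadowLabel-<-injective : ∀ {i j} → i < j → j < N → shadowLabel i ≢ shadowLabel j
  shadowLabel-<-injective {i} {j} i<j j<N same =
    <⇒≱ (≤-<-trans (m∸n≤m j i) j<N) (∣⇒≤ {{>-nonZero (m<n⇒0<n∸m i<j)}} N∣j∸i)
    where
    j≡[j∸i]+i : j ≡ (j ∸ i) + i
    j≡[j∸i]+i = sym (m∸n+n≡m (<⇒≤ i<j))
    shift : (2 * (j ∸ i) + position i) % N ≡ position i % N
    shift = trans (cong (_% N) (sym (trans (cong position j≡[j∸i]+i) (position-+ (j ∸ i) i))))
                  (sym same)
    N∣j∸i : N ∣ j ∸ i
    N∣j∸i = coprime-divisor (¬2∣⇒coprime-2 N-odd) (%-shift⇒∣ (2 * (j ∸ i)) (position i) shift)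

  shadowLabel-injective : ∀ {i j} → i < N → j < N → i ≢ j → shadowLabel i ≢ shadowLabel j
  shadowLabel-injective {i} {j} i<N j<N i≢j with <-cmp i j
  ... | tri< i<j _ _ = shadowLabel-<-injective i<j j<N
  ... | tri≈ _ i≡j _ = contradiction i≡j i≢j
  ... | tri> _ _ j<i = shadowLabel-<-injective j<i i<N ∘ sym

  shadowLabel-last : ∀ {n} → N ≡ suc n → shadowLabel n ≡ n
  shadowLabel-last {n} N≡1+n = begin
    position n % N ≡⟨ cong (_% N) (trans (position≡ n) (cong (n +_) (sym N≡1+n))) ⟩
    (n + N) % N    ≡⟨ [m+n]%n≡m%n n N ⟩
    n % N          ≡⟨ m<n⇒m%n≡m (subst (n <_) (sym N≡1+n) ≤-refl) ⟩
    n              ∎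
    where open ≡-Reasoning

  private
    gap : ∀ g d x → T (g ≤ᵇ d) → T (g + d ≤ᵇ 10) → g ≤ ∣ (d + x) % N - x % N ∣
    gap g d x g≤d g+d≤10 = %-gap d x (≤ᵇ⇒≤ g d g≤d) (≤-trans (≤ᵇ⇒≤ (g + d) 10 g+d≤10) 10≤N)

    gap′ : ∀ g d x → T (g ≤ᵇ d) → T (g + d ≤ᵇ 10) → g ≤ ∣ x % N - (d + x) % N ∣
    gap′ g d x g≤d g+d≤10 = ∣-∣-swap ((d + x) % N) (x % N) (gap g d x g≤d g+d≤10)

    below-N : ∀ x {c} → N ≤ c → suc (x % N) ≤ c
    below-N x N≤c = <-≤-trans (m%n<n x N) N≤c

  hasL21Within : ∀ n c → n ≤ N → N ≤ c → (∀ i → i < n → 2 + shadowLabel i ≤ c) →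
                 HasL21Within (Mycielski (Path n)) c
  hasL21Within n c n≤N N≤c shadow-low =
    pathMycielskiLabelling originalLabel shadowLabel c , pathConstraints⇒isL21 constraints , bounded
    where
    constraints : PathConstraints n originalLabel shadowLabel c
    constraints = record
      { originals-adjacent        = λ i _ → gap′ 2 2 (5 + position i) tt tt
      ; original-next-shadow      = λ i _ → gap  2 3 (2 + position i) tt tt
      ; shadow-next-original      = λ i _ → gap′ 2 7 (position i) tt tt
      ; shadow-apex               = λ i i<n → +≤⇒≤∣m-n∣ _ c (shadow-low i i<n)
      ; originals-two-apart       = λ i _ → gap′ 1 4 (5 + position i) tt tt
      ; original-shadow-two-apart = λ i _ → gap  1 1 (4 + position i) tt tt
      ; shadow-original-two-apart = λ i _ → gap′ 1 9 (position i) tt tt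
      ; original-own-shadow       = λ i _ → gap  1 5 (position i) tt tt
      ; original-apex             = λ i _ → +≤⇒≤∣m-n∣ _ c (below-N (5 + position i) N≤c)
      ; shadows-injective         = λ i j i<n j<n →
                                      shadowLabel-injective (<-≤-trans i<n n≤N) (<-≤-trans j<n n≤N)
      }
    bounded : ∀ v → pathMycielskiLabelling originalLabel shadowLabel c v ≤ c
    bounded (original i) = <⇒≤ (below-N (5 + position (toℕ i)) N≤c)
    bounded (shadow i)   = <⇒≤ (below-N (position (toℕ i)) N≤c)
    bounded apex         = ≤-refl

  hasL21Within-odd : HasL21Within (Mycielski (Path N)) (N + 1)
  hasL21Within-odd = hasL21Within N (N + 1) ≤-refl (m≤m+n N 1)
    (λ i _ → subst (2 + shadowLabel i ≤_) (+-comm 1 N) (s≤s (m%n<n (position i) N)))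

  hasL21Within-even : ∀ n → N ≡ suc n → HasL21Within (Mycielski (Path n)) (n + 1)
  hasL21Within-even n N≡1+n = hasL21Within n (n + 1) n≤N N≤n+1 low
    where
    n<N : n < N
    n<N = subst (n <_) (sym N≡1+n) ≤-refl
    n≤N : n ≤ N
    n≤N = <⇒≤ n<N
    N≤n+1 : N ≤ n + 1
    N≤n+1 = ≤-reflexive (trans N≡1+n (+-comm 1 n))
    low : ∀ i → i < n → 2 + shadowLabel i ≤ n + 1
    low i i<n = subst (2 + shadowLabel i ≤_) (+-comm 1 n) (s≤s (≤∧≢⇒< ≤n ≢n))
      where
      ≤n : shadowLabel i ≤ n
      ≤n = s≤s⁻¹ (subst (shadowLabel i <_) N≡1+n (m%n<n (position i) N))
      ≢n : shadowLabel i ≢ n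
      ≢n eq = shadowLabel-<-injective i<n n<N (trans eq (sym (shadowLabel-last N≡1+n)))

hasL21Within-≥10 : ∀ n → 10 ≤ n → HasL21Within (Mycielski (Path n)) (n + 1)
hasL21Within-≥10 (suc n) 10≤1+n with 2 ∣? suc n
... | no  1+n-odd  = CyclicLabelling.hasL21Within-odd (suc n) 1+n-odd 10≤1+n
... | yes 1+n-even =
  CyclicLabelling.hasL21Within-even (2 + n) 2+n-odd (m≤n⇒m≤1+n 10≤1+n) (suc n) refl
  where
  2+n-odd : ¬ 2 ∣ 2 + n
  2+n-odd 2∣2+n =
    contradiction (∣1⇒≡1 (∣m+n∣m⇒∣n (subst (2 ∣_) (+-comm 1 (suc n)) 2∣2+n) 1+n-even)) λ ()

hasL21Within-≥6 : ∀ k → HasL21Within (Mycielski (Path (6 + k))) (6 + k + 1)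
hasL21Within-≥6 0 = MycielskiPath.hasL21Within 6 7
  (3 ∷ 6 ∷ 1 ∷ 4 ∷ 7 ∷ 1 ∷ []) (4 ∷ 7 ∷ 2 ∷ 3 ∷ 6 ∷ 5 ∷ []) 0 tt
hasL21Within-≥6 1 = MycielskiPath.hasL21Within 7 8
  (7 ∷ 4 ∷ 1 ∷ 8 ∷ 5 ∷ 1 ∷ 3 ∷ []) (6 ∷ 5 ∷ 2 ∷ 3 ∷ 4 ∷ 7 ∷ 8 ∷ []) 0 tt
hasL21Within-≥6 2 = MycielskiPath.hasL21Within 8 9
  (8 ∷ 4 ∷ 1 ∷ 7 ∷ 9 ∷ 1 ∷ 3 ∷ 9 ∷ []) (9 ∷ 6 ∷ 2 ∷ 3 ∷ 4 ∷ 5 ∷ 7 ∷ 8 ∷ []) 0 tt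
hasL21Within-≥6 3 = MycielskiPath.hasL21Within 9 10
  (1 ∷ 4 ∷ 7 ∷ 1 ∷ 3 ∷ 6 ∷ 1 ∷ 3 ∷ 5 ∷ []) (2 ∷ 3 ∷ 6 ∷ 5 ∷ 4 ∷ 7 ∷ 8 ∷ 9 ∷ 10 ∷ []) 0 tt
hasL21Within-≥6 (suc (suc (suc (suc k)))) = hasL21Within-≥10 (10 + k) (m≤m+n 10 k)

λ-MP₃ : LambdaIs (Mycielski (Path 3)) 6
λ-MP₃ = MycielskiPath.hasL21Within 3 6 (0 ∷ 2 ∷ 5 ∷ []) (4 ∷ 3 ∷ 6 ∷ []) 1 tt
      , ¬hasL21Within⇒< (MycielskiPath.¬hasL21Within 3 5 refl)

λ-MP₄ : LambdaIs (Mycielski (Path 4)) 6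
λ-MP₄ = MycielskiPath.hasL21Within 4 6 (6 ∷ 0 ∷ 2 ∷ 5 ∷ []) (5 ∷ 4 ∷ 3 ∷ 6 ∷ []) 1 tt
      , ¬hasL21Within⇒< (MycielskiPath.¬hasL21Within 4 5 refl)

λ-MP₅ : LambdaIs (Mycielski (Path 5)) 7
λ-MP₅ = MycielskiPath.hasL21Within 5 7 (6 ∷ 3 ∷ 0 ∷ 5 ∷ 2 ∷ []) (5 ∷ 2 ∷ 1 ∷ 4 ∷ 3 ∷ []) 7 tt
      , ¬hasL21Within⇒< (MycielskiPath.¬hasL21Within 5 6 refl)

λ-MP≥6 : ∀ k → LambdaIs (Mycielski (Path (6 + k))) (6 + k + 1)
λ-MP≥6 k = hasL21Within-≥6 k , λ _ → mycielski-λ≥1+ id id (s≤s z≤n)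

proposition3p1 : (n : ℕ) → 3 ≤ n →
    (n ≤ 4 → LambdaIs (Mycielski (Path n)) 6) ×
    (n ≡ 5 → LambdaIs (Mycielski (Path n)) 7) ×
    (6 ≤ n → LambdaIs (Mycielski (Path n)) (n + 1))
proposition3p1 0 ()
proposition3p1 1 (s≤s ())
proposition3p1 2 (s≤s (s≤s ()))
proposition3p1 3 _ = (λ _ → λ-MP₃) , (λ ()) , λ { (s≤s (s≤s (s≤s ()))) }
proposition3p1 4 _ = (λ _ → λ-MP₄) , (λ ()) , λ { (s≤s (s≤s (s≤s (s≤s ())))) }
proposition3p1 5 _ =
  (λ { (s≤s (s≤s (s≤s (s≤s ())))) }) , (λ _ → λ-MP₅) , λ { (s≤s (s≤s (s≤s (s≤s (s≤s ()))))) }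
proposition3p1 (suc (suc (suc (suc (suc (suc k)))))) _ =
  (λ { (s≤s (s≤s (s≤s (s≤s ())))) }) , (λ ()) , λ _ → λ-MP≥6 k
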